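{- Let $a_1,\ldots,a_n$ be nonnegative integers with $j$ entries equal to $0$, $k$ entries positive and even, and $l$ entries odd, $n=j+k+l$. If $j,k,l\ge0$ are all even and $k+l\ge3$, then $RT(a_1,\ldots,a_n)$ is super edge-graceful.
   Context: For a finite simple graph $G$ with $p$ vertices and $q$ edges, $G$ is super edge-graceful if there is a bijection $f$ from $E(G)$ onto $\{0,\pm1,\ldots,\pm\frac{q-1}{2}\}$ when $q$ is odd, and onto $\{\pm1,\ldots,\pm\frac{q}{2}\}$ when $q$ is even, such that the induced vertex labeling $f^+(v)=\sum_{uv\in E(G)} f(uv)$ is a bijection from $V(G)$ onto $\{0,\pm1,\ldots,\pm\frac{p-1}{2}\}$ when $p$ is odd, and onto $\{\pm1,\ldots,\pm\frac{p}{2}\}$ when $p$ is even. For nonnegative integers $a_1,\ldots,a_n$, $RT(a_1,\ldots,a_n)$ is the rooted tree with root $v_0$, children $v_1,\ldots,v_n$ of $v_0$, where $v_i$ has exactly $a_i$ children, all of which are leaves. -}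

module Defs where

open import Data.Nat using (ℕ; zero; suc; _+_; _*_; _∸_; _≤_; _<_; _%_; _/_)
open import Data.Nat.Divisibility using (_∣_)
import Data.Nat as ℕ
open import Data.Integer using (ℤ; ∣_∣; +_)
import Data.Integer as ℤ
open import Data.Fin using (Fin; toℕ)
open import Data.Fin.Properties using ()
open import Data.List using (List; []; _∷_; length; map; upTo; filter; lookup; _++_)
open import Data.Nat.ListAction using (sum)
open import Data.Product using (_×_; _,_; proj₁; proj₂; Σ; ∃)
open import Data.Bool using (Bool; true; false; if_then_else_; _∨_)
open import Relation.Nullary using (¬_; ⌊_⌋)
open import Relation.Binary.PropositionalEquality using (_≡_; _≢_)
open import Function.Definitions using (Injective)

InLabels : ℕ → ℤ → Set
InLabels m z =
  (m % 2 ≡ 1 → ∣ z ∣ ≤ (m ∸ 1) / 2) ×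
  (m % 2 ≡ 0 → (z ≢ + 0) × (∣ z ∣ ≤ m / 2))

BijectionOnto : {A : Set} → (A → ℤ) → (ℤ → Set) → Set
BijectionOnto {A} f S =
  Injective _≡_ _≡_ f × (∀ x → S (f x)) × (∀ z → S z → ∃ λ x → f x ≡ z)

-- Finite graphs: p vertices 0,…,p-1 and an edge list of endpoint pairs
-- (edge e joins proj₁ e and proj₂ e).

sumFin : (n : ℕ) → (Fin n → ℤ) → ℤ
sumFin zero    g = + 0
sumFin (suc n) g = g Fin.zero ℤ.+ sumFin n (λ i → g (Fin.suc i))
  where import Data.Fin as Fin

incident : ℕ → ℕ × ℕ → Bool
incident v (a , b) = ⌊ v ℕ.≟ a ⌋ ∨ ⌊ v ℕ.≟ b ⌋

induced : (es : List (ℕ × ℕ)) → (Fin (length es) → ℤ) → ℕ → ℤ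
induced es f v =
  sumFin (length es) (λ e → if incident v (lookup es e) then f e else + 0)

SuperEdgeGraceful : (p : ℕ) → (es : List (ℕ × ℕ)) → Set
SuperEdgeGraceful p es =
  Σ (Fin (length es) → ℤ) λ f →
    BijectionOnto f (InLabels (length es)) ×
    BijectionOnto (λ (v : Fin p) → induced es f (toℕ v)) (InLabels p)

-- The rooted tree RT(a₁,…,aₙ):
-- root = 0, children v_i = i (1 ≤ i ≤ n), leaves numbered n+1, n+2, …;
-- v_i gets a_i fresh leaf children.

rtEdges : ℕ → ℕ → List ℕ → List (ℕ × ℕ)
rtEdges i nxt []       = []
rtEdges i nxt (a ∷ as) =
  ((0 , i) ∷ map (λ t → (i , nxt + t)) (upTo a)) ++ rtEdges (suc i) (nxt + a) as

RT-edges : List ℕ → List (ℕ × ℕ)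
RT-edges as = rtEdges 1 (suc (length as)) as

RT-order : List ℕ → ℕ
RT-order as = suc (length as + sum as)

RTSuperEdgeGraceful : List ℕ → Set
RTSuperEdgeGraceful as = SuperEdgeGraceful (RT-order as) (RT-edges as)

isZero isPosEven isOdd : ℕ → Bool
isZero zero = true
isZero (suc _) = false
isPosEven zero = false
isPosEven (suc n) = ⌊ (suc n) % 2 ℕ.≟ 0 ⌋
isOdd n = ⌊ n % 2 ℕ.≟ 1 ⌋

count : (ℕ → Bool) → List ℕ → ℕ
count P [] = 0
count P (x ∷ xs) = (if P x then 1 else 0) + count P xs

numZero numPosEven numOdd : List ℕ → ℕ
numZero = count isZero
numPosEven = count isPosEven
numOdd = count isOdd

module Submission where

open import Defs
open import Data.Nat using (ℕ; _+_; _≤_)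
open import Data.Nat.Divisibility using (_∣_)
open import Data.List using (List; length)
open import Relation.Binary.PropositionalEquality using (_≡_)

-- RT(a₁,…,aₙ) with 2m odd and 2r even entries is super edge-graceful; the construction
-- never uses the hypothesis k + l ≥ 3.  The proof has two independent halves.
--
-- Give every child vᵢ a block: a spoke label for
--     v₀vᵢ and aᵢ leaf labels.  If the spokes and leaves form a rearrangement of ±[1, M],
--     so do the block sums (spoke + leaves) and the leaves, and the spokes sum to 0, then
--     the induced labelling is f⁺(v₀) = 0, f⁺(vᵢ) = block sum, f⁺(leaf) = its edge label,
--     and both labellings are bijections onto the prescribed label sets (q = 2M, p = 2M+1).
--
-- The i-th pair of even children gets spokes
--     ±(2m+i), the t-th pair of odd children gets spokes ∓(2t+1) and one extra leaf each
--     labelled ±2(m-t), and all other leaves are labelled by pairs ±(2m+r+1), ±(2m+r+2), ….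
--     Processing the children left to right, closed forms of the labels used so far are
--     maintained; at the end they are ±[1, 2m+r+E], the spokes cancel, and the odd children's
--     vertex labels ±|2(m-t) - (2t+1)| are again the odd numbers below 2m.
--
-- The theorem follows by counting the even entries as the zero and the positive even ones.

open import Data.Nat using (zero; suc; _*_; _∸_; _<_; z≤n; s≤s; _%_; _/_; _≟_; ⌊_/2⌋)
import Data.Nat.Properties as ℕP
open import Data.Nat.Divisibility using (divides)
open import Data.Nat.DivMod using (m*n/n≡m)
open import Data.Nat.ListAction using (sum)
open import Algebra.Properties.CommutativeSemigroup ℕP.+-commutativeSemigroup using (interchange)
open import Data.Integer using (ℤ; +_; -[1+_]; -_; ∣_∣; _⊖_) renaming (_+_ to _+ℤ_)
import Data.Integer.Properties as ℤP
open import Data.Bool using (Bool; true; false; if_then_else_; not)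
open import Data.List
  using ([]; _∷_; [_]; _++_; _∷ʳ_; map; concatMap; foldr; tabulate; applyUpTo; upTo)
import Data.List.Properties as LP
open import Data.List.Relation.Binary.Permutation.Propositional renaming (trans to trans↭)
import Data.List.Relation.Binary.Permutation.Setoid.Properties as PermutationSetoid
open import Data.List.Relation.Binary.Permutation.Propositional.Properties
  using (∈-resp-↭; ↭-length; map⁺; ++⁺ˡ; ++⁺ʳ; ++⁺; shift; shifts; ++-comm; ∷↭∷ʳ)
import Data.List.Relation.Unary.All as All
import Data.List.Relation.Unary.All.Properties as All
open import Data.List.Relation.Unary.AllPairs using ([]; _∷_)
open import Data.List.Relation.Unary.Unique.Propositional using (Unique)
open import Data.List.Relation.Unary.Any using (here; there)
open import Data.List.Membership.Propositional using (_∈_; _∉_)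
open import Data.List.Membership.Propositional.Properties
  using (∈-tabulate⁺; ∈-tabulate⁻; ∈-++⁺ˡ; ∈-++⁺ʳ)
open import Data.Fin using (Fin; toℕ)
import Data.Fin as Fin
open import Data.Product using (_×_; _,_; proj₁; proj₂; ∃)
open import Data.Sum using (_⊎_; inj₁; inj₂)
open import Data.Empty using (⊥-elim)
open import Relation.Nullary using (yes; no)
open import Relation.Binary.PropositionalEquality
  using (_≢_; refl; sym; trans; cong; cong₂; subst; setoid; module ≡-Reasoning)
open import Function.Bundles using (_⇔_; mk⇔; Equivalence)
open import Function.Definitions using (Injective)

sumℤ : List ℤ → ℤ
sumℤ = foldr _+ℤ_ (+ 0)

sumℤ-↭ : {xs ys : List ℤ} → xs ↭ ys → sumℤ xs ≡ sumℤ ys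
sumℤ-↭ p =
  PermutationSetoid.foldr-commMonoid (setoid ℤ) ℤP.+-0-isCommutativeMonoid (↭⇒↭ₛ p)

Unique-resp-↭ : {A : Set} {xs ys : List A} → xs ↭ ys → Unique xs → Unique ys
Unique-resp-↭ {A} p = PermutationSetoid.Unique-resp-↭ (setoid A) (↭⇒↭ₛ p)

tabulate-injective : {A : Set} {n : ℕ} (h : Fin n → A) →
  Unique (tabulate h) → Injective _≡_ _≡_ h
tabulate-injective h (h0∉ ∷ _) {Fin.zero}  {Fin.zero}  _ = refl
tabulate-injective h (h0∉ ∷ _) {Fin.zero}  {Fin.suc j} e = ⊥-elim (All.tabulate⁻ h0∉ j e)
tabulate-injective h (h0∉ ∷ _) {Fin.suc i} {Fin.zero}  e = ⊥-elim (All.tabulate⁻ h0∉ i (sym e))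
tabulate-injective h (_ ∷ u)   {Fin.suc i} {Fin.suc j} e =
  cong Fin.suc (tabulate-injective (λ i → h (Fin.suc i)) u e)

bijection-via-↭ : {n : ℕ} (h : Fin n → ℤ) (S : ℤ → Set) (L : List ℤ) →
  tabulate h ↭ L → Unique L → (∀ z → S z ⇔ z ∈ L) → BijectionOnto h S
bijection-via-↭ h S L h↭L uniq S⇔L =
  tabulate-injective h (Unique-resp-↭ (↭-sym h↭L) uniq) ,
  (λ i → Equivalence.from (S⇔L (h i)) (∈-resp-↭ h↭L (∈-tabulate⁺ i))) ,
  (λ z Sz → let (i , z≡hi) = ∈-tabulate⁻ (∈-resp-↭ (↭-sym h↭L) (Equivalence.to (S⇔L z) Sz))
            in i , sym z≡hi)

-- double n = 2n, by a recursion that computes well against pattern matching.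
double : ℕ → ℕ
double zero    = zero
double (suc n) = suc (suc (double n))

double≡*2 : ∀ n → double n ≡ n * 2
double≡*2 zero    = refl
double≡*2 (suc n) = cong (λ t → suc (suc t)) (double≡*2 n)

double%2 : ∀ n → double n % 2 ≡ 0
double%2 zero    = refl
double%2 (suc n) = double%2 n

1+double%2 : ∀ n → suc (double n) % 2 ≡ 1
1+double%2 zero    = refl
1+double%2 (suc n) = 1+double%2 n

double/2 : ∀ n → double n / 2 ≡ n
double/2 n = trans (cong (_/ 2) (double≡*2 n)) (m*n/n≡m n 2)

applyUpTo-cong : {A : Set} {f g : ℕ → A} (n : ℕ) →
  (∀ t → t < n → f t ≡ g t) → applyUpTo f n ≡ applyUpTo g n
applyUpTo-cong zero    f≗g = refl
applyUpTo-cong (suc n) f≗g =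
  cong₂ _∷_ (f≗g 0 (s≤s z≤n)) (applyUpTo-cong n (λ t t<n → f≗g (suc t) (s≤s t<n)))

range : ℕ → ℕ → List ℕ
range a zero    = []
range a (suc c) = a ∷ range (suc a) c

length-range : ∀ a c → length (range a c) ≡ c
length-range a zero    = refl
length-range a (suc c) = cong suc (length-range (suc a) c)

range-++ : ∀ a c d → range a c ++ range (a + c) d ≡ range a (c + d)
range-++ a zero    d = cong (λ b → range b d) (ℕP.+-identityʳ a)
range-++ a (suc c) d =
  cong (a ∷_) (trans (cong (λ b → range (suc a) c ++ range b d) (ℕP.+-suc a c))
                     (range-++ (suc a) c d))

∈-range⁻ : ∀ {x} a c → x ∈ range a c → a ≤ x × x < a + c
∈-range⁻ a (suc c) (here refl) = ℕP.≤-refl , ℕP.m<m+n a (s≤s z≤n)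
∈-range⁻ {x} a (suc c) (there x∈) =
  let (a<x , x<) = ∈-range⁻ (suc a) c x∈
  in ℕP.<⇒≤ a<x , subst (x <_) (sym (ℕP.+-suc a c)) x<

∈-range⁺ : ∀ {x} a c → a ≤ x → x < a + c → x ∈ range a c
∈-range⁺ {x} a zero    a≤x x<a+0 =
  ⊥-elim (ℕP.<⇒≱ x<a+0 (subst (_≤ x) (sym (ℕP.+-identityʳ a)) a≤x))
∈-range⁺ {x} a (suc c) a≤x x< with a ≟ x
... | yes refl = here refl
... | no  a≢x  =
  there (∈-range⁺ (suc a) c (ℕP.≤∧≢⇒< a≤x a≢x) (subst (x <_) (ℕP.+-suc a c) x<))

range-unique : ∀ a c → Unique (range a c)
range-unique a zero    = []
range-unique a (suc c) =
  All.¬Any⇒All¬ _ (λ a∈ → ℕP.<-irrefl refl (proj₁ (∈-range⁻ (suc a) c a∈)))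
  ∷ range-unique (suc a) c

map-range : {A : Set} (f : ℕ → A) (a c : ℕ) → map f (range a c) ≡ applyUpTo (λ t → f (a + t)) c
map-range f a zero    = refl
map-range f a (suc c) =
  cong₂ _∷_ (cong f (sym (ℕP.+-identityʳ a)))
    (trans (map-range f (suc a) c) (applyUpTo-cong c (λ t _ → cong f (sym (ℕP.+-suc a t)))))

map-cong-range : {A : Set} (f g : ℕ → A) (a c : ℕ) →
  (∀ v → a ≤ v → v < a + c → f v ≡ g v) → map f (range a c) ≡ map g (range a c)
map-cong-range f g a c f≗g =
  LP.map-cong-local
    (All.tabulate (λ {v} v∈ → let (a≤v , v<) = ∈-range⁻ a c v∈ in f≗g v a≤v v<))

tabulate-toℕ : {A : Set} (n : ℕ) (g : ℕ → A) →
  tabulate (λ (v : Fin n) → g (toℕ v)) ≡ map g (range 0 n)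
tabulate-toℕ n g = trans (tabulate-applyUpTo n g) (sym (map-range g 0 n))
  where
  tabulate-applyUpTo : {A : Set} (n : ℕ) (g : ℕ → A) →
    tabulate (λ (v : Fin n) → g (toℕ v)) ≡ applyUpTo g n
  tabulate-applyUpTo zero    g = refl
  tabulate-applyUpTo (suc n) g = cong (g 0 ∷_) (tabulate-applyUpTo n (λ t → g (suc t)))

pm : List ℤ → List ℤ
pm []       = []
pm (z ∷ zs) = z ∷ - z ∷ pm zs

signed : List ℕ → List ℤ
signed xs = pm (map +_ xs)

pm-++ : ∀ xs ys → pm (xs ++ ys) ≡ pm xs ++ pm ys
pm-++ []       ys = refl
pm-++ (x ∷ xs) ys = cong (λ t → x ∷ - x ∷ t) (pm-++ xs ys)

signed-++ : ∀ xs ys → signed (xs ++ ys) ≡ signed xs ++ signed ys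
signed-++ xs ys = trans (cong pm (LP.map-++ +_ xs ys)) (pm-++ (map +_ xs) (map +_ ys))

pm-↭ : {xs ys : List ℤ} → xs ↭ ys → pm xs ↭ pm ys
pm-↭ refl         = refl
pm-↭ (prep x p)   = prep x (prep (- x) (pm-↭ p))
pm-↭ (swap x y p) =
  ↭-trans (shifts (x ∷ - x ∷ []) (y ∷ - y ∷ [])) (++⁺ˡ (y ∷ - y ∷ x ∷ - x ∷ []) (pm-↭ p))
pm-↭ (trans↭ p q) = ↭-trans (pm-↭ p) (pm-↭ q)

signed-↭ : {xs ys : List ℕ} → xs ↭ ys → signed xs ↭ signed ys
signed-↭ p = pm-↭ (map⁺ +_ p)

pm-abs : ∀ zs → pm zs ↭ signed (map ∣_∣ zs)
pm-abs []               = refl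
pm-abs (+ n ∷ zs)       = prep (+ n) (prep (- + n) (pm-abs zs))
pm-abs (-[1+ n ] ∷ zs)  = swap -[1+ n ] (+ suc n) (pm-abs zs)

sumℤ-pm : ∀ zs → sumℤ (pm zs) ≡ + 0
sumℤ-pm []       = refl
sumℤ-pm (z ∷ zs) = begin
  z +ℤ (- z +ℤ sumℤ (pm zs)) ≡⟨ sym (ℤP.+-assoc z (- z) _) ⟩
  (z +ℤ - z) +ℤ sumℤ (pm zs) ≡⟨ cong₂ _+ℤ_ (ℤP.+-inverseʳ z) (sumℤ-pm zs) ⟩
  + 0                        ∎
  where open ≡-Reasoning

length-signed : ∀ xs → length (signed xs) ≡ double (length xs)
length-signed []       = refl
length-signed (x ∷ xs) = cong (λ t → suc (suc t)) (length-signed xs)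

∈-signed⁻ : ∀ {z} xs → z ∈ signed xs → ∃ λ x → x ∈ xs × (z ≡ + x ⊎ z ≡ - + x)
∈-signed⁻ (x ∷ xs) (here refl)         = x , here refl , inj₁ refl
∈-signed⁻ (x ∷ xs) (there (here refl)) = x , here refl , inj₂ refl
∈-signed⁻ (x ∷ xs) (there (there z∈))  =
  let (y , y∈ , z≡±y) = ∈-signed⁻ xs z∈ in y , there y∈ , z≡±y

∈-signed⁺ : ∀ {x} xs → x ∈ xs → + x ∈ signed xs × - + x ∈ signed xs
∈-signed⁺ (x ∷ xs) (here refl) = here refl , there (here refl)
∈-signed⁺ (y ∷ xs) (there x∈)  =
  let (p , n) = ∈-signed⁺ xs x∈ in there (there p) , there (there n)

signed-unique : ∀ xs → Unique xs → 0 ∉ xs → Unique (signed xs)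
signed-unique []       []         0∉ = []
signed-unique (x ∷ xs) (x∉ ∷ uxs) 0∉ =
  All.¬Any⇒All¬ _ +x∉ ∷ All.¬Any⇒All¬ _ -x∉ ∷ signed-unique xs uxs (λ 0∈ → 0∉ (there 0∈))
  where
  x≢0 : x ≢ 0
  x≢0 refl = 0∉ (here refl)
  +≢-+ : ∀ {a b} → a ≢ 0 → + a ≢ - + b
  +≢-+ {b = zero}  a≢0 e = a≢0 (ℤP.+-injective e)
  +≢-+ {b = suc b} a≢0 ()
  x∉xs : x ∉ xs
  x∉xs x∈ = All.lookup x∉ x∈ refl
  +x∉ : + x ∉ - + x ∷ signed xs
  +x∉ (here e)   = +≢-+ x≢0 e
  +x∉ (there z∈) with ∈-signed⁻ xs z∈
  ... | y , y∈ , inj₁ e = x∉xs (subst (_∈ xs) (sym (ℤP.+-injective e)) y∈)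
  ... | y , y∈ , inj₂ e = +≢-+ x≢0 e
  -x∉ : - + x ∉ signed xs
  -x∉ z∈ with ∈-signed⁻ xs z∈
  ... | y , y∈ , inj₁ e = +≢-+ (λ { refl → 0∉ (there y∈) }) (sym e)
  ... | y , y∈ , inj₂ e = x∉xs (subst (_∈ xs) (sym (ℤP.+-injective (ℤP.neg-injective e))) y∈)

-- labels M = ±[1, M]: the edge labels when q = 2M, and the nonzero vertex labels when p = 2M+1.
labels : ℕ → List ℤ
labels M = signed (range 1 M)

labels-unique : ∀ M → Unique (labels M)
labels-unique M = signed-unique (range 1 M) (range-unique 1 M)
  (λ 0∈ → ℕP.<-irrefl refl (proj₁ (∈-range⁻ 1 M 0∈)))

length-labels : ∀ M → length (labels M) ≡ double M
length-labels M = trans (length-signed (range 1 M)) (cong double (length-range 1 M))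

∈-labels : ∀ M z → z ∈ labels M ⇔ (z ≢ + 0 × ∣ z ∣ ≤ M)
∈-labels M z = mk⇔ to (from z)
  where
  to : z ∈ labels M → z ≢ + 0 × ∣ z ∣ ≤ M
  to z∈ with ∈-signed⁻ (range 1 M) z∈
  ... | suc x , x∈ , inj₁ refl = (λ ()) , ℕP.+-cancelˡ-≤ 1 _ _ (proj₂ (∈-range⁻ 1 M x∈))
  ... | suc x , x∈ , inj₂ refl = (λ ()) , ℕP.+-cancelˡ-≤ 1 _ _ (proj₂ (∈-range⁻ 1 M x∈))
  ... | zero  , x∈ , _         = ⊥-elim (ℕP.<-irrefl refl (proj₁ (∈-range⁻ 1 M x∈)))
  from : ∀ z → z ≢ + 0 × ∣ z ∣ ≤ M → z ∈ labels M
  from (+ zero)  (z≢0 , _)    = ⊥-elim (z≢0 refl)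
  from (+ suc n) (_ , ∣z∣≤M) = proj₁ (∈-signed⁺ (range 1 M) (∈-range⁺ 1 M (s≤s z≤n) (s≤s ∣z∣≤M)))
  from -[1+ n ]  (_ , ∣z∣≤M) = proj₂ (∈-signed⁺ (range 1 M) (∈-range⁺ 1 M (s≤s z≤n) (s≤s ∣z∣≤M)))

InLabels-even : ∀ M z → InLabels (double M) z ⇔ z ∈ labels M
InLabels-even M z = mk⇔ to from
  where
  0≢1 : 0 ≢ 1
  0≢1 ()
  to : InLabels (double M) z → z ∈ labels M
  to (_ , even) =
    let (z≢0 , ∣z∣≤) = even (double%2 M)
    in Equivalence.from (∈-labels M z) (z≢0 , subst (∣ z ∣ ≤_) (double/2 M) ∣z∣≤)
  from : z ∈ labels M → InLabels (double M) z
  from z∈ = let (z≢0 , ∣z∣≤M) = Equivalence.to (∈-labels M z) z∈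
            in (λ odd → ⊥-elim (0≢1 (trans (sym (double%2 M)) odd))) ,
               (λ _ → z≢0 , subst (∣ z ∣ ≤_) (sym (double/2 M)) ∣z∣≤M)

InLabels-odd : ∀ M z → InLabels (suc (double M)) z ⇔ z ∈ + 0 ∷ labels M
InLabels-odd M z =
  mk⇔ (λ inL → bounded z (subst (∣ z ∣ ≤_) (double/2 M) (proj₁ inL (1+double%2 M)))) from
  where
  1≢0 : 1 ≢ 0
  1≢0 ()
  bounded : ∀ z → ∣ z ∣ ≤ M → z ∈ + 0 ∷ labels M
  bounded (+ zero)   _     = here refl
  bounded (+ suc n)  ∣z∣≤M = there (Equivalence.from (∈-labels M (+ suc n)) ((λ ()) , ∣z∣≤M))
  bounded -[1+ n ]   ∣z∣≤M = there (Equivalence.from (∈-labels M -[1+ n ]) ((λ ()) , ∣z∣≤M))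
  from : z ∈ + 0 ∷ labels M → InLabels (suc (double M)) z
  from (here refl) = (λ _ → z≤n) , (λ even → ⊥-elim (1≢0 (trans (sym (1+double%2 M)) even)))
  from (there z∈)  =
    (λ _ → subst (∣ z ∣ ≤_) (sym (double/2 M)) (proj₂ (Equivalence.to (∈-labels M z) z∈))) ,
    (λ even → ⊥-elim (1≢0 (trans (sym (1+double%2 M)) even)))

-- A function on Fin n whose values are a rearrangement of ±[1, M] (resp. of 0, ±[1, M])
-- is a bijection onto the label set for n; the length of the list forces n = 2M (resp. 2M+1).
bijection-onto-labels : {n : ℕ} (h : Fin n → ℤ) (M : ℕ) →
  tabulate h ↭ labels M → BijectionOnto h (InLabels n)
bijection-onto-labels {n} h M h↭ =
  bijection-via-↭ h (InLabels n) (labels M) h↭ (labels-unique M)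
    (λ z → subst (λ k → InLabels k z ⇔ z ∈ labels M) (sym n≡2M) (InLabels-even M z))
  where
  n≡2M : n ≡ double M
  n≡2M = trans (sym (LP.length-tabulate h)) (trans (↭-length h↭) (length-labels M))

bijection-onto-labels₀ : {n : ℕ} (h : Fin n → ℤ) (M : ℕ) →
  tabulate h ↭ + 0 ∷ labels M → BijectionOnto h (InLabels n)
bijection-onto-labels₀ {n} h M h↭ =
  bijection-via-↭ h (InLabels n) (+ 0 ∷ labels M) h↭ unique
    (λ z → subst (λ k → InLabels k z ⇔ z ∈ + 0 ∷ labels M) (sym n≡2M+1) (InLabels-odd M z))
  where
  n≡2M+1 : n ≡ suc (double M)
  n≡2M+1 = trans (sym (LP.length-tabulate h)) (trans (↭-length h↭) (cong suc (length-labels M)))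
  unique : Unique (+ 0 ∷ labels M)
  unique = All.¬Any⇒All¬ _ (λ 0∈ → proj₁ (Equivalence.to (∈-labels M (+ 0)) 0∈) refl)
         ∷ labels-unique M

LabelledEdge : Set
LabelledEdge = (ℕ × ℕ) × ℤ

incident-other : ∀ {v a b} → v ≢ a → v ≢ b → incident v (a , b) ≡ false
incident-other {v} {a} {b} v≢a v≢b with v ≟ a | v ≟ b
... | yes v≡a | _       = ⊥-elim (v≢a v≡a)
... | no _    | yes v≡b = ⊥-elim (v≢b v≡b)
... | no _    | no _    = refl

incident-left : ∀ v b → incident v (v , b) ≡ true
incident-left v b with v ≟ v
... | yes _  = refl
... | no v≢v = ⊥-elim (v≢v refl)

incident-right : ∀ v a → incident v (a , v) ≡ true
incident-right v a with v ≟ a | v ≟ v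
... | yes _ | _      = refl
... | no _  | yes _  = refl
... | no _  | no v≢v = ⊥-elim (v≢v refl)

contribution : ℕ → LabelledEdge → ℤ
contribution v (e , z) = if incident v e then z else + 0

weight : ℕ → List LabelledEdge → ℤ
weight v []       = + 0
weight v (x ∷ xs) = contribution v x +ℤ weight v xs

weight-++ : ∀ v xs ys → weight v (xs ++ ys) ≡ weight v xs +ℤ weight v ys
weight-++ v []       ys = sym (ℤP.+-identityˡ _)
weight-++ v (x ∷ xs) ys =
  trans (cong (contribution v x +ℤ_) (weight-++ v xs ys)) (sym (ℤP.+-assoc (contribution v x) _ _))

weight-skip : ∀ v e z xs → incident v e ≡ false → weight v ((e , z) ∷ xs) ≡ weight v xs
weight-skip v e z xs v∉e rewrite v∉e = ℤP.+-identityˡ _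

weight-take : ∀ v e z xs → incident v e ≡ true → weight v ((e , z) ∷ xs) ≡ z +ℤ weight v xs
weight-take v e z xs v∈e rewrite v∈e = refl

edgeLabel : (xs : List LabelledEdge) → Fin (length (map proj₁ xs)) → ℤ
edgeLabel (x ∷ xs) Fin.zero    = proj₂ x
edgeLabel (x ∷ xs) (Fin.suc i) = edgeLabel xs i

tabulate-edgeLabel : ∀ xs → tabulate (edgeLabel xs) ≡ map proj₂ xs
tabulate-edgeLabel []       = refl
tabulate-edgeLabel (x ∷ xs) = cong (proj₂ x ∷_) (tabulate-edgeLabel xs)

induced-edgeLabel : ∀ xs v → induced (map proj₁ xs) (edgeLabel xs) v ≡ weight v xs
induced-edgeLabel []             v = refl
induced-edgeLabel ((e , z) ∷ xs) v = cong (contribution v (e , z) +ℤ_) (induced-edgeLabel xs v)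

-- The labels placed below a child vᵢ of the root: the label of the spoke v₀vᵢ and the
-- labels of the edges from vᵢ to its leaves.
Block : Set
Block = ℤ × List ℤ

spoke : Block → ℤ
spoke = proj₁

leaves : Block → List ℤ
leaves = proj₂

leafCount : Block → ℕ
leafCount b = length (leaves b)

blockSum : Block → ℤ
blockSum b = spoke b +ℤ sumℤ (leaves b)

leafEdges : ℕ → ℕ → List ℤ → List LabelledEdge
leafEdges i w []       = []
leafEdges i w (z ∷ zs) = ((i , w) , z) ∷ leafEdges i (suc w) zs

blockEdges : ℕ → ℕ → Block → List LabelledEdge
blockEdges i w b = ((0 , i) , spoke b) ∷ leafEdges i w (leaves b)

-- RT with children numbered from i and leaves from w, labelled block by block; its
-- underlying edge list is exactly rtEdges of Defs.
labelledRT : ℕ → ℕ → List Block → List LabelledEdge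
labelledRT i w []       = []
labelledRT i w (b ∷ bs) = blockEdges i w b ++ labelledRT (suc i) (w + leafCount b) bs

leafEdges-ends : ∀ i w ls →
  map proj₁ (leafEdges i w ls) ≡ map (λ t → (i , w + t)) (upTo (length ls))
leafEdges-ends i w ls = begin
  map proj₁ (leafEdges i w ls)             ≡⟨ ends w ls ⟩
  map (i ,_) (range w (length ls))         ≡⟨ map-range (i ,_) w (length ls) ⟩
  applyUpTo (λ t → (i , w + t)) (length ls) ≡⟨ sym (LP.map-upTo _ (length ls)) ⟩
  map (λ t → (i , w + t)) (upTo (length ls)) ∎
  where
  open ≡-Reasoning
  ends : ∀ w ls → map proj₁ (leafEdges i w ls) ≡ map (i ,_) (range w (length ls))
  ends w []       = refl
  ends w (z ∷ zs) = cong ((i , w) ∷_) (ends (suc w) zs)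

leafEdges-labels : ∀ i w ls → map proj₂ (leafEdges i w ls) ≡ ls
leafEdges-labels i w []       = refl
leafEdges-labels i w (z ∷ zs) = cong (z ∷_) (leafEdges-labels i (suc w) zs)

labelledRT-ends : ∀ i w bs → map proj₁ (labelledRT i w bs) ≡ rtEdges i w (map leafCount bs)
labelledRT-ends i w []       = refl
labelledRT-ends i w (b ∷ bs) =
  cong ((0 , i) ∷_) (trans (LP.map-++ proj₁ (leafEdges i w (leaves b)) _)
    (cong₂ _++_ (leafEdges-ends i w (leaves b)) (labelledRT-ends (suc i) (w + leafCount b) bs)))

labelledRT-labels : ∀ i w bs → map proj₂ (labelledRT i w bs) ↭ map spoke bs ++ concatMap leaves bs
labelledRT-labels i w []       = refl
labelledRT-labels i w (b ∷ bs) = prep (spoke b) (begin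
  map proj₂ (leafEdges i w ls ++ R)  ≡⟨ LP.map-++ proj₂ (leafEdges i w ls) R ⟩
  map proj₂ (leafEdges i w ls) ++ map proj₂ R
                                     ≡⟨ cong (_++ map proj₂ R) (leafEdges-labels i w ls) ⟩
  ls ++ map proj₂ R                  ↭⟨ ++⁺ˡ ls (labelledRT-labels (suc i) (w + leafCount b) bs) ⟩
  ls ++ (map spoke bs ++ concatMap leaves bs)
                                     ↭⟨ shifts ls (map spoke bs) ⟩
  map spoke bs ++ (ls ++ concatMap leaves bs) ∎)
  where
  open PermutationReasoning
  ls = leaves b
  R = labelledRT (suc i) (w + leafCount b) bs

∉-range-below : ∀ {x} a c → x < a → x ∉ range a c
∉-range-below a c x<a x∈ = ℕP.<⇒≱ x<a (proj₁ (∈-range⁻ a c x∈))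

∉-range-above : ∀ {x} a c → a + c ≤ x → x ∉ range a c
∉-range-above a c a+c≤x x∈ = ℕP.<⇒≱ (proj₂ (∈-range⁻ a c x∈)) a+c≤x

range-split : ∀ w (xs ys : List ℤ) →
  range w (length (xs ++ ys)) ≡ range w (length xs) ++ range (w + length xs) (length ys)
range-split w xs ys = trans (cong (range w) (LP.length-++ xs)) (sym (range-++ w (length xs) (length ys)))

weight-++ˡ : ∀ v xs ys → weight v xs ≡ + 0 → weight v (xs ++ ys) ≡ weight v ys
weight-++ˡ v xs ys xs≡0 =
  trans (weight-++ v xs ys) (trans (cong (_+ℤ weight v ys) xs≡0) (ℤP.+-identityˡ _))

weight-++ʳ : ∀ v xs ys → weight v ys ≡ + 0 → weight v (xs ++ ys) ≡ weight v xs
weight-++ʳ v xs ys ys≡0 =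
  trans (weight-++ v xs ys) (trans (cong (weight v xs +ℤ_) ys≡0) (ℤP.+-identityʳ _))

leafEdges-away : ∀ {v i} w ls → v ≢ i → v ∉ range w (length ls) →
  weight v (leafEdges i w ls) ≡ + 0
leafEdges-away w []       v≢i v∉ = refl
leafEdges-away {v} {i} w (z ∷ zs) v≢i v∉ =
  trans (weight-skip v (i , w) z (leafEdges i (suc w) zs)
           (incident-other v≢i (λ v≡w → v∉ (here v≡w))))
        (leafEdges-away (suc w) zs v≢i (λ v∈ → v∉ (there v∈)))

leafEdges-centre : ∀ i w ls → weight i (leafEdges i w ls) ≡ sumℤ ls
leafEdges-centre i w []       = refl
leafEdges-centre i w (z ∷ zs) =
  trans (weight-take i (i , w) z (leafEdges i (suc w) zs) (incident-left i w))
        (cong (z +ℤ_) (leafEdges-centre i (suc w) zs))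

leafEdges-leaves : ∀ i w ls → i < w →
  map (λ v → weight v (leafEdges i w ls)) (range w (length ls)) ≡ ls
leafEdges-leaves i w []       i<w = refl
leafEdges-leaves i w (z ∷ zs) i<w = cong₂ _∷_ own rest
  where
  own : weight w (leafEdges i w (z ∷ zs)) ≡ z
  own = trans (weight-take w (i , w) z (leafEdges i (suc w) zs) (incident-right w i))
    (trans (cong (z +ℤ_) (leafEdges-away (suc w) zs (λ w≡i → ℕP.<-irrefl (sym w≡i) i<w)
                            (∉-range-below (suc w) (length zs) (ℕP.n<1+n w))))
           (ℤP.+-identityʳ z))
  skip : ∀ v → suc w ≤ v → v < suc w + length zs →
    weight v (leafEdges i w (z ∷ zs)) ≡ weight v (leafEdges i (suc w) zs)
  skip v w<v _ = weight-skip v (i , w) z (leafEdges i (suc w) zs)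
    (incident-other (ℕP.>⇒≢ (ℕP.<-trans i<w w<v)) (ℕP.>⇒≢ w<v))
  rest : map (λ v → weight v (leafEdges i w (z ∷ zs))) (range (suc w) (length zs)) ≡ zs
  rest = trans (map-cong-range _ _ (suc w) (length zs) skip)
               (leafEdges-leaves i (suc w) zs (ℕP.m<n⇒m<1+n i<w))

blockEdges-away : ∀ {v i} w b → v ≢ 0 → v ≢ i → v ∉ range w (leafCount b) →
  weight v (blockEdges i w b) ≡ + 0
blockEdges-away {v} {i} w b v≢0 v≢i v∉ =
  trans (weight-skip v (0 , i) (spoke b) (leafEdges i w (leaves b)) (incident-other v≢0 v≢i))
        (leafEdges-away w (leaves b) v≢i v∉)

blockEdges-root : ∀ {i w} b → 1 ≤ i → 1 ≤ w → weight 0 (blockEdges i w b) ≡ spoke b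
blockEdges-root {i} {w} b 1≤i 1≤w =
  trans (weight-take 0 (0 , i) (spoke b) (leafEdges i w (leaves b)) (incident-left 0 i))
    (trans (cong (spoke b +ℤ_) (leafEdges-away w (leaves b) (λ 0≡i → ℕP.<-irrefl 0≡i 1≤i)
                                 (∉-range-below w (leafCount b) 1≤w)))
           (ℤP.+-identityʳ (spoke b)))

blockEdges-child : ∀ i w b → weight i (blockEdges i w b) ≡ blockSum b
blockEdges-child i w b =
  trans (weight-take i (0 , i) (spoke b) (leafEdges i w (leaves b)) (incident-right i 0))
        (cong (spoke b +ℤ_) (leafEdges-centre i w (leaves b)))

blockEdges-leaves : ∀ {i w} b → i < w →
  map (λ v → weight v (blockEdges i w b)) (range w (leafCount b)) ≡ leaves b
blockEdges-leaves {i} {w} b i<w =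
  trans (map-cong-range _ _ w (leafCount b) skipSpoke) (leafEdges-leaves i w (leaves b) i<w)
  where
  skipSpoke : ∀ v → w ≤ v → v < w + leafCount b →
    weight v (blockEdges i w b) ≡ weight v (leafEdges i w (leaves b))
  skipSpoke v w≤v _ = weight-skip v (0 , i) (spoke b) (leafEdges i w (leaves b))
    (incident-other (ℕP.m<n⇒n≢0 (ℕP.<-≤-trans i<w w≤v)) (ℕP.>⇒≢ (ℕP.<-≤-trans i<w w≤v)))

labelledRT-away : ∀ {v} i w bs → v ≢ 0 → v ∉ range i (length bs) →
  v ∉ range w (length (concatMap leaves bs)) → weight v (labelledRT i w bs) ≡ + 0
labelledRT-away i w []       _   _          _        = refl
labelledRT-away {v} i w (b ∷ bs) v≢0 v∉children v∉leaves =
  trans (weight-++ʳ v (blockEdges i w b) _ restAway)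
        (blockEdges-away w b v≢0 (λ v≡i → v∉children (here v≡i))
                                 (λ v∈ → v∉leaves (inLeaves (∈-++⁺ˡ v∈))))
  where
  inLeaves : v ∈ range w (leafCount b) ++ range (w + leafCount b) (length (concatMap leaves bs)) →
    v ∈ range w (length (concatMap leaves (b ∷ bs)))
  inLeaves = subst (v ∈_) (sym (range-split w (leaves b) (concatMap leaves bs)))
  restAway : weight v (labelledRT (suc i) (w + leafCount b) bs) ≡ + 0
  restAway = labelledRT-away (suc i) (w + leafCount b) bs v≢0 (λ v∈ → v∉children (there v∈))
    (λ v∈ → v∉leaves (inLeaves (∈-++⁺ʳ _ v∈)))

labelledRT-root : ∀ i w bs → 1 ≤ i → 1 ≤ w →
  weight 0 (labelledRT i w bs) ≡ sumℤ (map spoke bs)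
labelledRT-root i w []       _   _   = refl
labelledRT-root i w (b ∷ bs) 1≤i 1≤w =
  trans (weight-++ 0 (blockEdges i w b) _)
    (cong₂ _+ℤ_ (blockEdges-root b 1≤i 1≤w)
                (labelledRT-root (suc i) (w + leafCount b) bs (s≤s z≤n)
                                 (ℕP.≤-trans 1≤w (ℕP.m≤m+n w _))))

labelledRT-children : ∀ i w bs → 1 ≤ i → i + length bs ≤ w →
  map (λ v → weight v (labelledRT i w bs)) (range i (length bs)) ≡ map blockSum bs
labelledRT-children i w []       _   _      = refl
labelledRT-children i w (b ∷ bs) 1≤i i+n<w = cong₂ _∷_ own rest
  where
  n = length bs
  a = leafCount b
  blk = blockEdges i w b
  R = labelledRT (suc i) (w + a) bs
  i<w : i < w
  i<w = ℕP.<-≤-trans (ℕP.m<m+n i (s≤s z≤n)) i+n<w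
  1+i+n≤w : suc i + n ≤ w
  1+i+n≤w = subst (_≤ w) (ℕP.+-suc i n) i+n<w
  own : weight i (blk ++ R) ≡ blockSum b
  own = trans (weight-++ʳ i blk R (labelledRT-away (suc i) (w + a) bs (ℕP.m<n⇒n≢0 1≤i)
                                     (∉-range-below (suc i) n (ℕP.n<1+n i))
                                     (∉-range-below (w + a) _ (ℕP.<-≤-trans i<w (ℕP.m≤m+n w a)))))
              (blockEdges-child i w b)
  skipBlock : ∀ v → suc i ≤ v → v < suc i + n → weight v (blk ++ R) ≡ weight v R
  skipBlock v i<v v<1+i+n = weight-++ˡ v blk R
    (blockEdges-away w b (ℕP.m<n⇒n≢0 i<v) (ℕP.>⇒≢ i<v)
                         (∉-range-below w a (ℕP.<-≤-trans v<1+i+n 1+i+n≤w)))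
  rest : map (λ v → weight v (blk ++ R)) (range (suc i) n) ≡ map blockSum bs
  rest = trans (map-cong-range _ _ (suc i) n skipBlock)
    (labelledRT-children (suc i) (w + a) bs (s≤s z≤n) (ℕP.≤-trans 1+i+n≤w (ℕP.m≤m+n w a)))

labelledRT-leaves : ∀ i w bs → 1 ≤ i → i + length bs ≤ w →
  map (λ v → weight v (labelledRT i w bs)) (range w (length (concatMap leaves bs)))
  ≡ concatMap leaves bs
labelledRT-leaves i w []       _   _      = refl
labelledRT-leaves i w (b ∷ bs) 1≤i i+n<w = begin
  map G (range w (length (leaves b ++ L)))        ≡⟨ cong (map G) (range-split w (leaves b) L) ⟩
  map G (range w a ++ range (w + a) (length L))  ≡⟨ LP.map-++ G (range w a) _ ⟩
  map G (range w a) ++ map G (range (w + a) (length L)) ≡⟨ cong₂ _++_ own rest ⟩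
  leaves b ++ L                                  ∎
  where
  open ≡-Reasoning
  n = length bs
  a = leafCount b
  L = concatMap leaves bs
  blk = blockEdges i w b
  R = labelledRT (suc i) (w + a) bs
  G : ℕ → ℤ
  G v = weight v (blk ++ R)
  i<w : i < w
  i<w = ℕP.<-≤-trans (ℕP.m<m+n i (s≤s z≤n)) i+n<w
  1+i+n≤w : suc i + n ≤ w
  1+i+n≤w = subst (_≤ w) (ℕP.+-suc i n) i+n<w
  skipRest : ∀ v → w ≤ v → v < w + a → G v ≡ weight v blk
  skipRest v w≤v v<w+a = weight-++ʳ v blk R
    (labelledRT-away (suc i) (w + a) bs (ℕP.m<n⇒n≢0 (ℕP.<-≤-trans i<w w≤v))
      (∉-range-above (suc i) n (ℕP.≤-trans 1+i+n≤w w≤v))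
      (∉-range-below (w + a) (length L) v<w+a))
  own : map G (range w a) ≡ leaves b
  own = trans (map-cong-range G _ w a skipRest) (blockEdges-leaves b i<w)
  skipBlock : ∀ v → w + a ≤ v → v < w + a + length L → G v ≡ weight v R
  skipBlock v w+a≤v _ = weight-++ˡ v blk R
    (blockEdges-away w b (ℕP.m<n⇒n≢0 i<v) (ℕP.>⇒≢ i<v) (∉-range-above w a w+a≤v))
    where
    i<v : i < v
    i<v = ℕP.<-≤-trans i<w (ℕP.≤-trans (ℕP.m≤m+n w a) w+a≤v)
  rest : map G (range (w + a) (length L)) ≡ L
  rest = trans (map-cong-range G _ (w + a) (length L) skipBlock)
    (labelledRT-leaves (suc i) (w + a) bs (s≤s z≤n) (ℕP.≤-trans 1+i+n≤w (ℕP.m≤m+n w a)))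

labelledRT-vertices : ∀ bs n N → n ≡ length bs → N ≡ length (concatMap leaves bs) →
  map (λ v → weight v (labelledRT 1 (suc n) bs)) (range 0 (suc (n + N))) ≡
  sumℤ (map spoke bs) ∷ (map blockSum bs ++ concatMap leaves bs)
labelledRT-vertices bs n N refl refl =
  cong₂ _∷_ (labelledRT-root 1 (suc n) bs ℕP.≤-refl (s≤s z≤n)) (begin
    map G (range 1 (n + N))                ≡⟨ cong (map G) (sym (range-++ 1 n N)) ⟩
    map G (range 1 n ++ range (suc n) N)   ≡⟨ LP.map-++ G (range 1 n) _ ⟩
    map G (range 1 n) ++ map G (range (suc n) N)
      ≡⟨ cong₂ _++_ (labelledRT-children 1 (suc n) bs ℕP.≤-refl ℕP.≤-refl)
                    (labelledRT-leaves 1 (suc n) bs ℕP.≤-refl ℕP.≤-refl) ⟩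
    map blockSum bs ++ concatMap leaves bs ∎)
  where
  open ≡-Reasoning
  G : ℕ → ℤ
  G v = weight v (labelledRT 1 (suc n) bs)

leafCount-total : ∀ bs → sum (map leafCount bs) ≡ length (concatMap leaves bs)
leafCount-total []       = refl
leafCount-total (b ∷ bs) =
  trans (cong (λ t → leafCount b + t) (leafCount-total bs)) (sym (LP.length-++ (leaves b)))

RT-criterion : (bs : List Block) (M : ℕ) →
  map spoke bs ++ concatMap leaves bs ↭ labels M →
  map blockSum bs ++ concatMap leaves bs ↭ labels M →
  sumℤ (map spoke bs) ≡ + 0 →
  RTSuperEdgeGraceful (map leafCount bs)
RT-criterion bs M edges↭ vertices↭ spokes≡0 =
  subst (SuperEdgeGraceful p) (labelledRT-ends 1 w bs)
    (edgeLabel T , bijection-onto-labels (edgeLabel T) M edgeTable ,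
                   bijection-onto-labels₀ _ M vertexTable)
  where
  as = map leafCount bs
  w = suc (length as)
  p = RT-order as
  T = labelledRT 1 w bs
  edgeTable : tabulate (edgeLabel T) ↭ labels M
  edgeTable =
    ↭-trans (↭-reflexive (tabulate-edgeLabel T)) (↭-trans (labelledRT-labels 1 w bs) edges↭)
  vertexWeights : map (λ v → weight v T) (range 0 p) ≡ + 0 ∷ (map blockSum bs ++ concatMap leaves bs)
  vertexWeights =
    trans (labelledRT-vertices bs (length as) (sum as) (LP.length-map leafCount bs) (leafCount-total bs))
          (cong (_∷ (map blockSum bs ++ concatMap leaves bs)) spokes≡0)
  vertexTable :
    tabulate (λ (v : Fin p) → induced (map proj₁ T) (edgeLabel T) (toℕ v)) ↭ + 0 ∷ labels M
  vertexTable = ↭-trans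
    (↭-reflexive (trans (LP.tabulate-cong (λ v → induced-edgeLabel T (toℕ v)))
                        (trans (tabulate-toℕ p (λ v → weight v T)) vertexWeights)))
    (prep (+ 0) vertices↭)

alternate : (ℕ → ℤ) → ℕ → ℤ
alternate h zero          = h 0
alternate h (suc zero)    = - h 0
alternate h (suc (suc n)) = alternate (λ t → h (suc t)) n

applyUpTo-alternate : ∀ h s → applyUpTo (alternate h) (double s) ≡ pm (applyUpTo h s)
applyUpTo-alternate h zero    = refl
applyUpTo-alternate h (suc s) =
  cong (λ t → h 0 ∷ - h 0 ∷ t) (applyUpTo-alternate (λ t → h (suc t)) s)

alternate-+ : ∀ g h n → alternate g n +ℤ alternate h n ≡ alternate (λ t → g t +ℤ h t) n
alternate-+ g h zero          = refl
alternate-+ g h (suc zero)    = sym (ℤP.neg-distrib-+ (g 0) (h 0))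
alternate-+ g h (suc (suc n)) = alternate-+ (λ t → g (suc t)) (λ t → h (suc t)) n

oddNumber : ℕ → ℕ
oddNumber t = suc (double t)

odds-and-evens : ∀ m →
  applyUpTo oddNumber m ++ applyUpTo (λ t → double (m ∸ t)) m ↭ range 1 (double m)
odds-and-evens zero    = refl
odds-and-evens (suc m) = begin
  applyUpTo oddNumber (suc m) ++ double (suc m) ∷ E
    ≡⟨ cong (_++ double (suc m) ∷ E) (sym (LP.applyUpTo-∷ʳ oddNumber m)) ⟩
  (O ∷ʳ oddNumber m) ++ double (suc m) ∷ E  ≡⟨ LP.++-assoc O _ _ ⟩
  O ++ (new ++ E)                           ↭⟨ ++⁺ˡ O (++-comm new E) ⟩
  O ++ (E ++ new)                           ≡⟨ sym (LP.++-assoc O E new) ⟩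
  (O ++ E) ++ new                           ↭⟨ ++⁺ʳ new (odds-and-evens m) ⟩
  range 1 (double m) ++ range (suc (double m)) 2 ≡⟨ range-++ 1 (double m) 2 ⟩
  range 1 (double m + 2)                    ≡⟨ cong (range 1) (ℕP.+-comm (double m) 2) ⟩
  range 1 (double (suc m))                  ∎
  where
  open PermutationReasoning
  O = applyUpTo oddNumber m
  E = applyUpTo (λ t → double (m ∸ t)) m
  new = oddNumber m ∷ double (suc m) ∷ []

gap : ℕ → ℕ → ℕ
gap m t = ∣ double (m ∸ t) ⊖ oddNumber t ∣

gap-first : ∀ m → gap (suc (suc m)) 0 ≡ oddNumber (suc m)
gap-first m = trans (ℤP.∣m⊖n∣≡∣n⊖m∣ (double (suc (suc m))) 1) (ℤP.∣⊖∣-≤ (s≤s z≤n))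

gap-shift : ∀ m t → t ≤ m → gap (suc (suc m)) (suc t) ≡ gap m t
gap-shift m t t≤m = begin
  ∣ double (suc m ∸ t) ⊖ oddNumber (suc t) ∣
    ≡⟨ cong (λ k → ∣ double k ⊖ oddNumber (suc t) ∣) (ℕP.+-∸-assoc 1 t≤m) ⟩
  ∣ suc (suc (double (m ∸ t))) ⊖ suc (suc (oddNumber t)) ∣
    ≡⟨ cong ∣_∣ (ℤP.[1+m]⊖[1+n]≡m⊖n (suc (double (m ∸ t))) (suc (oddNumber t))) ⟩
  ∣ suc (double (m ∸ t)) ⊖ suc (oddNumber t) ∣
    ≡⟨ cong ∣_∣ (ℤP.[1+m]⊖[1+n]≡m⊖n (double (m ∸ t)) (oddNumber t)) ⟩
  ∣ double (m ∸ t) ⊖ oddNumber t ∣ ∎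
  where open ≡-Reasoning

gap-last : ∀ m → gap (suc (suc m)) (suc m) ≡ oddNumber m
gap-last m = begin
  ∣ double (suc m ∸ m) ⊖ oddNumber (suc m) ∣
    ≡⟨ cong (λ k → ∣ double k ⊖ oddNumber (suc m) ∣) (ℕP.m+n∸n≡m 1 m) ⟩
  ∣ 2 ⊖ oddNumber (suc m) ∣                  ≡⟨ ℤP.∣⊖∣-≤ (s≤s (s≤s z≤n)) ⟩
  oddNumber m                                ∎
  where open ≡-Reasoning

-- Peeling off t = 0 and t = m + 1 reduces gap (m + 2) to gap m, whose values are shifted in.
odd-gaps : ∀ m → applyUpTo (gap m) m ↭ applyUpTo oddNumber m
odd-gaps zero          = refl
odd-gaps (suc zero)    = refl
odd-gaps (suc (suc m)) = begin
  gap (2 + m) 0 ∷ applyUpTo (λ t → gap (2 + m) (suc t)) (suc m)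
    ≡⟨ cong₂ _∷_ (gap-first m) (sym (LP.applyUpTo-∷ʳ (λ t → gap (2 + m) (suc t)) m)) ⟩
  oddNumber (suc m) ∷ (applyUpTo (λ t → gap (2 + m) (suc t)) m ∷ʳ gap (2 + m) (suc m))
    ≡⟨ cong (oddNumber (suc m) ∷_)
         (cong₂ _∷ʳ_ (applyUpTo-cong m (λ t t<m → gap-shift m t (ℕP.<⇒≤ t<m))) (gap-last m)) ⟩
  oddNumber (suc m) ∷ (applyUpTo (gap m) m ∷ʳ oddNumber m)
    ↭⟨ ∷↭∷ʳ (oddNumber (suc m)) _ ⟩
  (applyUpTo (gap m) m ∷ʳ oddNumber m) ∷ʳ oddNumber (suc m)
    ↭⟨ ++⁺ʳ _ (++⁺ʳ _ (odd-gaps m)) ⟩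
  (applyUpTo oddNumber m ∷ʳ oddNumber m) ∷ʳ oddNumber (suc m)
    ≡⟨ cong (_∷ʳ oddNumber (suc m)) (LP.applyUpTo-∷ʳ oddNumber m) ⟩
  applyUpTo oddNumber (suc m) ∷ʳ oddNumber (suc m)
    ≡⟨ LP.applyUpTo-∷ʳ oddNumber (suc m) ⟩
  applyUpTo oddNumber (2 + m) ∎
  where open PermutationReasoning

concatMap-singleton : {A : Set} (f : Block → A) (bs : List Block) →
  concatMap (λ b → [ f b ]) bs ≡ map f bs
concatMap-singleton f bs = trans (sym (LP.concatMap-map [_] f bs)) (LP.concatMap-pure (map f bs))

halves : ∀ a → (if isOdd a then suc (double ⌊ a /2⌋) else double ⌊ a /2⌋) ≡ a
halves zero       = refl
halves (suc zero) = refl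
halves (suc (suc a)) with isOdd a | halves a
... | true  | a≡ = cong (λ t → suc (suc t)) a≡
... | false | a≡ = cong (λ t → suc (suc t)) a≡

-- Children are processed in order,
-- remembering how many even and odd children and how many leaf pairs have been labelled.
--   * even children, in pairs t = 0, …, r-1, get spoke labels 2m+1+t and -(2m+1+t);
--   * odd children, in pairs t = 0, …, m-1, get spoke labels -(2t+1) and 2t+1 and one extra
--     leaf each, labelled 2(m-t) and -2(m-t), so their vertex labels are ±(2(m-t) - (2t+1));
--   * all other leaves come in pairs labelled ±(C+1), ±(C+2), … with C = 2m + r.
module Scheme (m r : ℕ) where

  C : ℕ
  C = double m + r

  evenSpoke oddSpoke oddExtra oddSum : ℕ → ℤ
  evenSpoke = alternate (λ t → + suc (double m + t))
  oddSpoke  = alternate (λ t → - + oddNumber t)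
  oddExtra  = alternate (λ t → + double (m ∸ t))
  oddSum o  = oddSpoke o +ℤ oddExtra o

  leafPairs : ℕ → ℕ → List ℤ
  leafPairs e h = signed (range (suc C + e) h)

  record Seen : Set where
    constructor seen
    field evens odds pairs : ℕ
  open Seen

  block : Seen → ℕ → Block
  block (seen f o e) a =
    if isOdd a then (oddSpoke o , oddExtra o ∷ leafPairs e ⌊ a /2⌋)
               else (evenSpoke f , leafPairs e ⌊ a /2⌋)

  next : Seen → ℕ → Seen
  next (seen f o e) a =
    if isOdd a then seen f (suc o) (e + ⌊ a /2⌋) else seen (suc f) o (e + ⌊ a /2⌋)

  schedule : Seen → List ℕ → List Block
  schedule σ []       = []
  schedule σ (a ∷ as) = block σ a ∷ schedule (next σ a) as

  final : Seen → List ℕ → Seen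
  final σ []       = σ
  final σ (a ∷ as) = final (next σ a) as

  start : Seen
  start = seen 0 0 0

  length-leafPairs : ∀ e h → length (leafPairs e h) ≡ double h
  length-leafPairs e h =
    trans (length-signed (range (suc C + e) h)) (cong double (length-range (suc C + e) h))

  block-leafCount : ∀ σ a → leafCount (block σ a) ≡ a
  block-leafCount (seen f o e) a with isOdd a | halves a
  ... | true  | a≡ = trans (cong suc (length-leafPairs e ⌊ a /2⌋)) a≡
  ... | false | a≡ = trans (length-leafPairs e ⌊ a /2⌋) a≡

  schedule-leafCounts : ∀ σ as → map leafCount (schedule σ as) ≡ as
  schedule-leafCounts σ []       = refl
  schedule-leafCounts σ (a ∷ as) =
    cong₂ _∷_ (block-leafCount σ a) (schedule-leafCounts (next σ a) as)

  final-evens : ∀ σ as → evens (final σ as) ≡ evens σ + count (λ a → not (isOdd a)) as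
  final-evens σ            []       = sym (ℕP.+-identityʳ (evens σ))
  final-evens (seen f o e) (a ∷ as) with isOdd a
  ... | true  = final-evens (seen f (suc o) (e + ⌊ a /2⌋)) as
  ... | false = trans (final-evens (seen (suc f) o (e + ⌊ a /2⌋)) as) (sym (ℕP.+-suc f _))

  final-odds : ∀ σ as → odds (final σ as) ≡ odds σ + numOdd as
  final-odds σ            []       = sym (ℕP.+-identityʳ (odds σ))
  final-odds (seen f o e) (a ∷ as) with isOdd a
  ... | true  = trans (final-odds (seen f (suc o) (e + ⌊ a /2⌋)) as) (sym (ℕP.+-suc o _))
  ... | false = final-odds (seen (suc f) o (e + ⌊ a /2⌋)) as

  -- Invariant bookkeeping: K σ lists (up to order) what the children seen so far contributed
  -- to some label list; if every step preserves this, so does the whole schedule.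
  accumulate : (K : Seen → List ℤ) (F : Block → List ℤ) →
    (∀ σ a → K σ ++ F (block σ a) ↭ K (next σ a)) →
    ∀ σ as → K σ ++ concatMap F (schedule σ as) ↭ K (final σ as)
  accumulate K F step σ []       = ↭-reflexive (LP.++-identityʳ (K σ))
  accumulate K F step σ (a ∷ as) = begin
    K σ ++ (F (block σ a) ++ concatMap F (schedule (next σ a) as)) ≡⟨ sym (LP.++-assoc (K σ) _ _) ⟩
    (K σ ++ F (block σ a)) ++ concatMap F (schedule (next σ a) as) ↭⟨ ++⁺ʳ _ (step σ a) ⟩
    K (next σ a) ++ concatMap F (schedule (next σ a) as)           ↭⟨ accumulate K F step (next σ a) as ⟩
    K (final (next σ a) as) ∎
    where open PermutationReasoning

  spokesSoFar sumsSoFar leavesSoFar : Seen → List ℤ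
  spokesSoFar (seen f o e) = applyUpTo evenSpoke f ++ applyUpTo oddSpoke o
  sumsSoFar   (seen f o e) = applyUpTo evenSpoke f ++ applyUpTo oddSum o
  leavesSoFar (seen f o e) = applyUpTo oddExtra o ++ signed (range (suc C) e)

  extend-left : ∀ (g h : ℕ → ℤ) f o →
    (applyUpTo g f ++ applyUpTo h o) ++ [ g f ] ↭ applyUpTo g (suc f) ++ applyUpTo h o
  extend-left g h f o = begin
    (G ++ H) ++ [ g f ]   ≡⟨ LP.++-assoc G H _ ⟩
    G ++ (H ++ [ g f ])   ↭⟨ ++⁺ˡ G (++-comm H [ g f ]) ⟩
    G ++ ([ g f ] ++ H)   ≡⟨ sym (LP.++-assoc G _ H) ⟩
    (G ∷ʳ g f) ++ H       ≡⟨ cong (_++ H) (LP.applyUpTo-∷ʳ g f) ⟩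
    applyUpTo g (suc f) ++ H ∎
    where
    open PermutationReasoning
    G = applyUpTo g f
    H = applyUpTo h o

  extend-right : ∀ (g h : ℕ → ℤ) f o →
    (applyUpTo g f ++ applyUpTo h o) ++ [ h o ] ↭ applyUpTo g f ++ applyUpTo h (suc o)
  extend-right g h f o = ↭-reflexive
    (trans (LP.++-assoc (applyUpTo g f) _ _) (cong (applyUpTo g f ++_) (LP.applyUpTo-∷ʳ h o)))

  spokes-step : ∀ σ a → spokesSoFar σ ++ [ spoke (block σ a) ] ↭ spokesSoFar (next σ a)
  spokes-step (seen f o e) a with isOdd a
  ... | true  = extend-right evenSpoke oddSpoke f o
  ... | false = extend-left evenSpoke oddSpoke f o

  -- The leaf pairs sum to 0, so a child's vertex label is its spoke plus its extra leaf.
  sumℤ-leafPairs : ∀ e h → sumℤ (leafPairs e h) ≡ + 0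
  sumℤ-leafPairs e h = sumℤ-pm (map +_ (range (suc C + e) h))

  sums-step : ∀ σ a → sumsSoFar σ ++ [ blockSum (block σ a) ] ↭ sumsSoFar (next σ a)
  sums-step (seen f o e) a with isOdd a
  ... | true  = ↭-trans (↭-reflexive (cong (λ s → sumsSoFar (seen f o e) ++ [ s ]) oddChild))
                        (extend-right evenSpoke oddSum f o)
    where
    oddChild : oddSpoke o +ℤ (oddExtra o +ℤ sumℤ (leafPairs e ⌊ a /2⌋)) ≡ oddSum o
    oddChild = trans (cong (λ s → oddSpoke o +ℤ (oddExtra o +ℤ s)) (sumℤ-leafPairs e ⌊ a /2⌋))
                     (cong (oddSpoke o +ℤ_) (ℤP.+-identityʳ (oddExtra o)))
  ... | false = ↭-trans (↭-reflexive (cong (λ s → sumsSoFar (seen f o e) ++ [ s ]) evenChild))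
                        (extend-left evenSpoke oddSum f o)
    where
    evenChild : evenSpoke f +ℤ sumℤ (leafPairs e ⌊ a /2⌋) ≡ evenSpoke f
    evenChild =
      trans (cong (evenSpoke f +ℤ_) (sumℤ-leafPairs e ⌊ a /2⌋)) (ℤP.+-identityʳ (evenSpoke f))

  pairs-++ : ∀ e h → signed (range (suc C) e) ++ leafPairs e h ≡ signed (range (suc C) (e + h))
  pairs-++ e h = trans (sym (signed-++ (range (suc C) e) _)) (cong signed (range-++ (suc C) e h))

  leaves-step : ∀ σ a → leavesSoFar σ ++ leaves (block σ a) ↭ leavesSoFar (next σ a)
  leaves-step (seen f o e) a with isOdd a
  ... | true  = begin
    (X ++ P) ++ oddExtra o ∷ Q    ≡⟨ LP.++-assoc X P _ ⟩
    X ++ (P ++ [ oddExtra o ] ++ Q) ↭⟨ ++⁺ˡ X (shift (oddExtra o) P Q) ⟩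
    X ++ (oddExtra o ∷ P ++ Q)    ≡⟨ sym (LP.++-assoc X _ (P ++ Q)) ⟩
    (X ∷ʳ oddExtra o) ++ (P ++ Q) ≡⟨ cong₂ _++_ (LP.applyUpTo-∷ʳ oddExtra o) (pairs-++ e ⌊ a /2⌋) ⟩
    applyUpTo oddExtra (suc o) ++ signed (range (suc C) (e + ⌊ a /2⌋)) ∎
    where
    open PermutationReasoning
    X = applyUpTo oddExtra o
    P = signed (range (suc C) e)
    Q = leafPairs e ⌊ a /2⌋
  ... | false = ↭-reflexive (trans (LP.++-assoc (applyUpTo oddExtra o) _ _)
                                   (cong (applyUpTo oddExtra o ++_) (pairs-++ e ⌊ a /2⌋)))

  evenSpokes : applyUpTo evenSpoke (double r) ≡ signed (range (suc (double m)) r)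
  evenSpokes = trans (applyUpTo-alternate _ r) (cong pm (sym (map-range +_ (suc (double m)) r)))

  oddSpokes : applyUpTo oddSpoke (double m) ↭ signed (applyUpTo oddNumber m)
  oddSpokes = begin
    applyUpTo oddSpoke (double m)                    ≡⟨ applyUpTo-alternate h m ⟩
    pm (applyUpTo h m)                               ↭⟨ pm-abs (applyUpTo h m) ⟩
    signed (map ∣_∣ (applyUpTo h m))                 ≡⟨ cong signed (LP.map-applyUpTo h ∣_∣ m) ⟩
    signed (applyUpTo oddNumber m)                   ∎
    where
    open PermutationReasoning
    h : ℕ → ℤ
    h t = - + oddNumber t

  oddExtras : applyUpTo oddExtra (double m) ≡ signed (applyUpTo (λ t → double (m ∸ t)) m)
  oddExtras = trans (applyUpTo-alternate _ m) (cong pm (sym (LP.map-applyUpTo _ +_ m)))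

  oddSums : applyUpTo oddSum (double m) ↭ signed (applyUpTo oddNumber m)
  oddSums = begin
    applyUpTo oddSum (double m)        ≡⟨ applyUpTo-cong (double m) (λ t _ → alternate-+ _ _ t) ⟩
    applyUpTo (alternate h) (double m) ≡⟨ applyUpTo-alternate h m ⟩
    pm (applyUpTo h m)                 ↭⟨ pm-abs (applyUpTo h m) ⟩
    signed (map ∣_∣ (applyUpTo h m))   ≡⟨ cong signed (LP.map-applyUpTo h ∣_∣ m) ⟩
    signed (applyUpTo (gap m) m)       ↭⟨ signed-↭ (odd-gaps m) ⟩
    signed (applyUpTo oddNumber m)     ∎
    where
    open PermutationReasoning
    h : ℕ → ℤ
    h t = - + oddNumber t +ℤ + double (m ∸ t)

  allValues : ∀ E X Y → X ++ Y ↭ range 1 (double m) →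
    (range (suc (double m)) r ++ X) ++ (Y ++ range (suc C) E) ↭ range 1 (C + E)
  allValues E X Y XY↭ = begin
    (RF ++ X) ++ (Y ++ RL)         ≡⟨ LP.++-assoc RF X _ ⟩
    RF ++ (X ++ (Y ++ RL))         ≡⟨ cong (RF ++_) (sym (LP.++-assoc X Y RL)) ⟩
    RF ++ ((X ++ Y) ++ RL)         ↭⟨ shifts RF (X ++ Y) ⟩
    (X ++ Y) ++ (RF ++ RL)         ↭⟨ ++⁺ʳ _ XY↭ ⟩
    range 1 (double m) ++ (RF ++ RL) ≡⟨ sym (LP.++-assoc (range 1 (double m)) RF RL) ⟩
    (range 1 (double m) ++ RF) ++ RL ≡⟨ cong (_++ RL) (range-++ 1 (double m) r) ⟩
    range 1 C ++ RL                ≡⟨ range-++ 1 C E ⟩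
    range 1 (C + E)                ∎
    where
    open PermutationReasoning
    RF = range (suc (double m)) r
    RL = range (suc C) E

  assemble : ∀ E X → X ↭ signed (applyUpTo oddNumber m) →
    (applyUpTo evenSpoke (double r) ++ X) ++ leavesSoFar (seen (double r) (double m) E) ↭ labels (C + E)
  assemble E X X↭ = begin
    (applyUpTo evenSpoke (double r) ++ X) ++ (applyUpTo oddExtra (double m) ++ signed RL)
      ↭⟨ ++⁺ (++⁺ (↭-reflexive evenSpokes) X↭) (↭-reflexive (cong (_++ signed RL) oddExtras)) ⟩
    (signed RF ++ signed O) ++ (signed V ++ signed RL)
      ≡⟨ sym (cong₂ _++_ (signed-++ RF O) (signed-++ V RL)) ⟩
    signed (RF ++ O) ++ signed (V ++ RL) ≡⟨ sym (signed-++ (RF ++ O) (V ++ RL)) ⟩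
    signed ((RF ++ O) ++ (V ++ RL))      ↭⟨ signed-↭ (allValues E O V (odds-and-evens m)) ⟩
    labels (C + E)                       ∎
    where
    open PermutationReasoning
    RF = range (suc (double m)) r
    RL = range (suc C) E
    O = applyUpTo oddNumber m
    V = applyUpTo (λ t → double (m ∸ t)) m

  edges-complete : ∀ σ → evens σ ≡ double r → odds σ ≡ double m →
    spokesSoFar σ ++ leavesSoFar σ ↭ labels (C + pairs σ)
  edges-complete (seen _ _ E) refl refl = assemble E _ oddSpokes

  vertices-complete : ∀ σ → evens σ ≡ double r → odds σ ≡ double m →
    sumsSoFar σ ++ leavesSoFar σ ↭ labels (C + pairs σ)
  vertices-complete (seen _ _ E) refl refl = assemble E _ oddSums

  spokes-balanced : ∀ σ → evens σ ≡ double r → odds σ ≡ double m →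
    sumℤ (spokesSoFar σ) ≡ + 0
  spokes-balanced (seen _ _ E) refl refl = begin
    sumℤ (applyUpTo evenSpoke (double r) ++ applyUpTo oddSpoke (double m))
      ≡⟨ sumℤ-↭ (++⁺ (↭-reflexive evenSpokes) oddSpokes) ⟩
    sumℤ (signed RF ++ signed O) ≡⟨ cong sumℤ (sym (signed-++ RF O)) ⟩
    sumℤ (signed (RF ++ O))      ≡⟨ sumℤ-pm (map +_ (RF ++ O)) ⟩
    + 0                          ∎
    where
    open ≡-Reasoning
    RF = range (suc (double m)) r
    O = applyUpTo oddNumber m

  scheme-graceful : ∀ as → count (λ a → not (isOdd a)) as ≡ double r → numOdd as ≡ double m →
    RTSuperEdgeGraceful as
  scheme-graceful as evens≡ odds≡ =
    subst RTSuperEdgeGraceful (schedule-leafCounts start as)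
      (RT-criterion bs (C + pairs σ)
        (↭-trans (++⁺ spokeLabels leafLabels) (edges-complete σ evensDone oddsDone))
        (↭-trans (++⁺ sumLabels leafLabels) (vertices-complete σ evensDone oddsDone))
        (trans (sumℤ-↭ spokeLabels) (spokes-balanced σ evensDone oddsDone)))
    where
    bs = schedule start as
    σ = final start as
    evensDone : evens σ ≡ double r
    evensDone = trans (final-evens start as) evens≡
    oddsDone : odds σ ≡ double m
    oddsDone = trans (final-odds start as) odds≡
    spokeLabels : map spoke bs ↭ spokesSoFar σ
    spokeLabels = subst (_↭ spokesSoFar σ) (concatMap-singleton spoke bs)
      (accumulate spokesSoFar (λ b → [ spoke b ]) spokes-step start as)
    sumLabels : map blockSum bs ↭ sumsSoFar σ
    sumLabels = subst (_↭ sumsSoFar σ) (concatMap-singleton blockSum bs)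
      (accumulate sumsSoFar (λ b → [ blockSum b ]) sums-step start as)
    leafLabels : concatMap leaves bs ↭ leavesSoFar σ
    leafLabels = accumulate leavesSoFar leaves leaves-step start as

count-+ : ∀ (P Q R : ℕ → Bool) →
  (∀ a → (if P a then 1 else 0) + (if Q a then 1 else 0) ≡ (if R a then 1 else 0)) →
  ∀ as → count P as + count Q as ≡ count R as
count-+ P Q R split []       = refl
count-+ P Q R split (a ∷ as) =
  trans (interchange (if P a then 1 else 0) (count P as) (if Q a then 1 else 0) (count Q as))
        (cong₂ _+_ (split a) (count-+ P Q R split as))

zero-or-positive-even : ∀ a →
  (if isZero a then 1 else 0) + (if isPosEven a then 1 else 0) ≡ (if not (isOdd a) then 1 else 0)
zero-or-positive-even zero                = refl
zero-or-positive-even (suc zero)          = refl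
zero-or-positive-even (suc (suc zero))    = refl
zero-or-positive-even (suc (suc (suc a))) = zero-or-positive-even (suc a)

-- With l = 2l′ odd and j + k = 2(j′ + k′) even entries the scheme applies.
lemma10 : (as : List ℕ) (j k l : ℕ) →
    numZero as ≡ j → numPosEven as ≡ k → numOdd as ≡ l →
    2 ∣ j → 2 ∣ k → 2 ∣ l → 3 ≤ k + l →
    RTSuperEdgeGraceful as
lemma10 as j k l zeros≡ posEvens≡ odds≡ (divides j′ j≡) (divides k′ k≡) (divides l′ l≡) _ =
  Scheme.scheme-graceful l′ (j′ + k′) as evens≡ (trans odds≡ (trans l≡ (sym (double≡*2 l′))))
  where
  open ≡-Reasoning
  evens≡ : count (λ a → not (isOdd a)) as ≡ double (j′ + k′)
  evens≡ = begin
    count (λ a → not (isOdd a)) as ≡⟨ sym (count-+ isZero isPosEven _ zero-or-positive-even as) ⟩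
    numZero as + numPosEven as     ≡⟨ cong₂ _+_ zeros≡ posEvens≡ ⟩
    j + k                          ≡⟨ cong₂ _+_ j≡ k≡ ⟩
    j′ * 2 + k′ * 2                ≡⟨ sym (ℕP.*-distribʳ-+ 2 j′ k′) ⟩
    (j′ + k′) * 2                  ≡⟨ sym (double≡*2 (j′ + k′)) ⟩
    double (j′ + k′)               ∎
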